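{- Let $\Gamma=G_1\square\cdots\square G_m$ be a Cartesian product of finite graphs and let $G$ be an induced subgraph of $\Gamma$. Let $i\in\{1,\ldots,m\}$ and $uv\in E(G_i)$, and let $\widehat\Gamma$ and $G_{uv}$ be as in the context. Then (1) $\mathrm{vcd}^*(G_{uv})\le\mathrm{vcd}^*(G)$ and (2) $\mathrm{vcdens}^*(G_{uv})\le\mathrm{vcdens}^*(G)$, where the invariants of $G_{uv}$ are computed with respect to $\widehat\Gamma$ and those of $G$ with respect to $\Gamma$.
   Context: All graphs finite, simple, undirected. The Cartesian product has vertex set $V(G_1)\times\cdots\times V(G_m)$, two tuples adjacent iff they differ in exactly one coordinate $j$ where they are adjacent in $G_j$. $\widehat G_i$ is the graph obtained from $G_i$ by contracting the edge $uv$ into a new vertex $w$ (every edge $xu$ or $xv$ becomes a single edge $xw$; no loops or multiple edges), and $\widehat\Gamma=G_1\square\cdots\square G_{i-1}\square\widehat G_i\square G_{i+1}\square\cdots\square G_m$. Let $\varphi:V(\Gamma)\to V(\widehat\Gamma)$ replace the $i$-th coordinate by $w$ if it is $u$ or $v$ and leave the vertex unchanged otherwise; $G_{uv}$ is the subgraph of $\widehat\Gamma$ induced by $\varphi(V(G))$ (i.e. $G$ with all edges of type $uv$ contracted). For a graph $F$, $\mathrm{dens}(F)=\max|E(F')|/|V(F')|$ over subgraphs. For a product $\Pi=F_1\square\cdots\square F_m$ and a subgraph $K$: a minor-subproduct of $\Pi$ is $M=M_1\square\cdots\square M_m$ where, for each $j$, $\mathcal P_j=\{P^j_1,\ldots,P^j_{t_j}\}$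 is a partition of $V(F_j)$ into sets inducing connected subgraphs and $M_j$ is a graph on vertex set $\mathcal P_j$ such that parts adjacent in $M_j$ are joined by an edge of $F_j$; $M$ is shattered by $K$ if every set $P^1_{l_1}\times\cdots\times P^m_{l_m}$ contains a vertex of $K$. A factor is non-trivial if it has at least two vertices. $\mathrm{vcd}^*(K)$ is the largest number of non-trivial factors of a minor-subproduct of $\Pi$ shattered by $K$, and $\mathrm{vcdens}^*(K)$ the largest $\mathrm{dens}(M)$ of a minor-subproduct $M$ of $\Pi$ shattered by $K$. -}

module Defs where

open import Level using (0ℓ)
open import Data.Nat using (ℕ; zero; suc; _+_; _*_; _≤_; pred)
open import Data.Nat.Properties using (_≤?_)
open import Data.Fin using (Fin; zero; suc; punchOut)
open import Data.Fin.Properties using (_≟_)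
open import Data.Product using (Σ; ∃; ∃₂; _×_; _,_; proj₁)
open import Data.Sum using (_⊎_)
open import Data.List using (List; length)
open import Data.List.Relation.Unary.Any using (Any)
open import Data.List.Relation.Unary.All using (All)
open import Data.List.Relation.Unary.AllPairs using (AllPairs)
open import Relation.Nullary using (¬_; yes; no)
open import Relation.Binary.PropositionalEquality using (_≡_; _≢_; refl; sym)
open import Function using (_∘_)

record Graph : Set₁ where
  field
    n      : ℕ
    Adj    : Fin n → Fin n → Set
    adj-sym    : ∀ {x y} → Adj x y → Adj y x
    adj-irrefl : ∀ {x} → ¬ Adj x x
open Graph public

module _ {m : ℕ} (F : Fin m → Graph) where

  PV : Set
  PV = (j : Fin m) → Fin (n (F j))

  PAdj : PV → PV → Set
  PAdj x y = Σ (Fin m) λ j → Adj (F j) (x j) (y j) × (∀ k → k ≢ j → x k ≡ y k)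

  PEq : PV → PV → Set
  PEq x y = ∀ j → x j ≡ y j

-- the map V(G) → V(Ĝ) identifying v with u (the new vertex w is the
-- common image of u and v; all other vertices are relabelled injectively)
contractMap : ∀ {k} (u v : Fin k) → u ≢ v → Fin k → Fin (pred k)
contractMap {suc k} u v u≢v x with x ≟ v
... | yes _   = punchOut {i = v} {j = u} (u≢v ∘ sym)
... | no x≢v  = punchOut {i = v} {j = x} (x≢v ∘ sym)

contract : (G : Graph) (u v : Fin (n G)) → Adj G u v → Graph
contract G u v e = record
  { n      = pred (n G)
  ; Adj    = λ a b → a ≢ b × ∃₂ λ x y → f x ≡ a × f y ≡ b × Adj G x y
  ; adj-sym    = λ { (a≢b , x , y , fx , fy , xy) →
                 (a≢b ∘ sym) , y , x , fy , fx , Graph.adj-sym G xy }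
  ; adj-irrefl = λ p → proj₁ p refl
  }
  where
  u≢v : u ≢ v
  u≢v refl = Graph.adj-irrefl G e
  f = contractMap u v u≢v

module _ {m : ℕ} (F : Fin m → Graph) (i : Fin m) (u v : Fin (n (F i)))
         (e : Adj (F i) u v) where

  hatF : Fin m → Graph
  hatF j with i ≟ j
  ... | yes _ = contract (F i) u v e
  ... | no  _ = F j

  φ : PV F → PV hatF
  φ x j with i ≟ j
  ... | yes refl = contractMap u v (λ { refl → Graph.adj-irrefl (F i) e }) (x i)
  ... | no  _    = x j

  -- vertex set of G_uv (induced subgraph of Γ̂ on φ(V(G))), G given by
  -- its vertex set S (G is an induced subgraph of Γ)
  contractedSet : (PV F → Set) → PV hatF → Set
  contractedSet S y = ∃ λ x → S x × PEq hatF (φ x) y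

data WalkIn (G : Graph) (P : Fin (n G) → Set) : Fin (n G) → Fin (n G) → Set where
  here : ∀ {x} → P x → WalkIn G P x x
  step : ∀ {x y z} → P x → Adj G x y → WalkIn G P y z → WalkIn G P x z

record MinorSubproduct {m : ℕ} (F : Fin m → Graph) : Set₁ where
  field
    -- M_j, a graph on the set of parts (parts indexed by Fin (n (M j)))
    M     : Fin m → Graph
    part  : (j : Fin m) → Fin (n (F j)) → Fin (n (M j))
    part-nonempty : ∀ j (l : Fin (n (M j))) → ∃ λ x → part j x ≡ l
    part-connected : ∀ j x y → part j x ≡ part j y →
                     WalkIn (F j) (λ z → part j z ≡ part j x) x y
    M-edges : ∀ j a b → Adj (M j) a b →
              ∃₂ λ x y → part j x ≡ a × part j y ≡ b × Adj (F j) x y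
open MinorSubproduct public

Shattered : ∀ {m} {F : Fin m → Graph} → (PV F → Set) → MinorSubproduct F → Set
Shattered {F = F} K Mp =
  ∀ (l : PV (M Mp)) → ∃ λ x → K x × (∀ j → part Mp j (x j) ≡ l j)

countNontrivial : ∀ {m} → (Fin m → ℕ) → ℕ
countNontrivial {zero}  t = 0
countNontrivial {suc m} t with 2 ≤? t zero
... | yes _ = suc (countNontrivial (t ∘ suc))
... | no  _ = countNontrivial (t ∘ suc)

nontrivialFactors : ∀ {m} {F : Fin m → Graph} → MinorSubproduct F → ℕ
nontrivialFactors Mp = countNontrivial (λ j → n (M Mp j))

record Subgraph {m : ℕ} (H : Fin m → Graph) : Set where
  field
    verts       : List (PV H)
    edges       : List (PV H × PV H)
    verts-dist  : AllPairs (λ x y → ¬ (PEq H x y)) verts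
    edges-adj   : All (λ p → PAdj H (Data.Product.proj₁ p) (Data.Product.proj₂ p)) edges
    edges-in    : All (λ p → Any (PEq H (Data.Product.proj₁ p)) verts
                           × Any (PEq H (Data.Product.proj₂ p)) verts) edges
    edges-dist  : AllPairs (λ p q →
                    ¬ ((PEq H (Data.Product.proj₁ p) (Data.Product.proj₁ q) ×
                        PEq H (Data.Product.proj₂ p) (Data.Product.proj₂ q))
                     ⊎ (PEq H (Data.Product.proj₁ p) (Data.Product.proj₂ q) ×
                        PEq H (Data.Product.proj₂ p) (Data.Product.proj₁ q)))) edges
open Subgraph public

#V #E : ∀ {m} {H : Fin m → Graph} → Subgraph H → ℕ
#V S = length (verts S)
#E S = length (edges S)

-- vcd*(G_uv) ≤ vcd*(G): for every minor-subproduct of Γ̂ shattered by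
-- G_uv there is a minor-subproduct of Γ shattered by G with at least as
-- many non-trivial factors (both maxima are over finite sets).
VcdLe : ∀ {m m'} (F : Fin m → Graph) (K : PV F → Set)
          (F' : Fin m' → Graph) (K' : PV F' → Set) → Set₁
VcdLe F K F' K' =
  ∀ (Mp : MinorSubproduct F) → Shattered K Mp →
  ∃ λ (Mp' : MinorSubproduct F') → Shattered K' Mp' ×
      nontrivialFactors Mp ≤ nontrivialFactors Mp'

-- vcdens*(K in F) ≤ vcdens*(K' in F'): for every shattered
-- minor-subproduct M and nonempty subgraph M₀ of M there is a shattered
-- minor-subproduct M' with a nonempty subgraph M₀' such that
-- |E(M₀)|/|V(M₀)| ≤ |E(M₀')|/|V(M₀')| (compared by cross-multiplication).
VcdensLe : ∀ {m m'} (F : Fin m → Graph) (K : PV F → Set)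
             (F' : Fin m' → Graph) (K' : PV F' → Set) → Set₁
VcdensLe F K F' K' =
  ∀ (Mp : MinorSubproduct F) → Shattered K Mp →
  ∀ (S : Subgraph (M Mp)) → 1 ≤ #V S →
  ∃ λ (Mp' : MinorSubproduct F') → Shattered K' Mp' ×
    ∃ λ (S' : Subgraph (M Mp')) → 1 ≤ #V S' × #E S * #V S' ≤ #E S' * #V S

module Submission where

-- Idea: call a map g : V(G) → V(H) a connected quotient if it is surjective,
-- its fibres induce connected subgraphs of G, and every edge of H lifts to an
-- edge of G.  Along a family of connected quotients g_j : F_j → H_j, every
-- minor-subproduct M of H_1 □ ⋯ □ H_m pulls back to a minor-subproduct of
-- F_1 □ ⋯ □ F_m with the SAME factor graphs M_j: the parts are the preimages
-- g_j⁻¹(P), which stay connected because walks lift through connected fibres.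
-- If every vertex of K' is the image of a vertex of K, then K shatters the
-- pullback whenever K' shatters M.
--
-- Since the pullback keeps M, both invariants
-- are compared by reflexivity.

open import Defs
open import Data.Nat using (ℕ; suc)
open import Data.Nat.Properties using (≤-refl)
open import Data.Fin using (Fin; punchIn)
open import Data.Fin.Properties
  using (_≟_; punchOut-cong; punchOut-injective; punchOut-punchIn; punchInᵢ≢i)
open import Data.Product using (∃; ∃₂; _×_; _,_)
open import Data.Sum using (_⊎_; inj₁; inj₂)
open import Data.Empty using (⊥-elim)
open import Relation.Nullary using (yes; no)
open import Relation.Binary.PropositionalEquality
  using (_≡_; _≢_; refl; sym; trans; cong; subst)
open import Function using (_∘_)

module _ {G : Graph} where

  walk-weaken : ∀ {P Q : Fin (n G) → Set} → (∀ z → P z → Q z) →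
                ∀ {x y} → WalkIn G P x y → WalkIn G Q x y
  walk-weaken P⇒Q (here px)      = here (P⇒Q _ px)
  walk-weaken P⇒Q (step px xy w) = step (P⇒Q _ px) xy (walk-weaken P⇒Q w)

  walk-append : ∀ {P : Fin (n G) → Set} {x y z} →
                WalkIn G P x y → WalkIn G P y z → WalkIn G P x z
  walk-append (here _)       w′ = w′
  walk-append (step px xy w) w′ = step px xy (walk-append w w′)

record ConnectedQuotient (G H : Graph) : Set where
  field
    map             : Fin (n G) → Fin (n H)
    surjective      : ∀ y → ∃ λ x → map x ≡ y
    fibre-connected : ∀ x y → map x ≡ map y →
                      WalkIn G (λ z → map z ≡ map x) x y
    lift-edge       : ∀ a b → Adj H a b →
                      ∃₂ λ x y → map x ≡ a × map y ≡ b × Adj G x y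

module _ {G H : Graph} (q : ConnectedQuotient G H) where
  open ConnectedQuotient q

  fibre-walk : (P : Fin (n H) → Set) {a : Fin (n H)} → P a →
               ∀ x y → map x ≡ a → map y ≡ a → WalkIn G (P ∘ map) x y
  fibre-walk P pa x y gx≡a gy≡a =
    walk-weaken (λ z gz≡gx → subst P (sym (trans gz≡gx gx≡a)) pa)
                (fibre-connected x y (trans gx≡a (sym gy≡a)))

  lift-walk : (P : Fin (n H) → Set) {a b : Fin (n H)} → WalkIn H P a b →
              ∀ x y → map x ≡ a → map y ≡ b → WalkIn G (P ∘ map) x y
  lift-walk P (here pa) x y gx gy = fibre-walk P pa x y gx gy
  lift-walk P (step pa ab w) x y gx gy with lift-edge _ _ ab
  ... | x₁ , y₁ , gx₁ , gy₁ , x₁y₁ =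
    walk-append (fibre-walk P pa x x₁ gx gx₁)
                (step (subst P (sym gx₁) pa) x₁y₁ (lift-walk P w y₁ y gy₁ gy))

identityQuotient : (G : Graph) → ConnectedQuotient G G
identityQuotient G = record
  { map             = λ x → x
  ; surjective      = λ y → y , refl
  ; fibre-connected = λ { x .x refl → here refl }
  ; lift-edge       = λ a b ab → a , b , refl , refl , ab
  }

module Pullback {m : ℕ} {F H : Fin m → Graph}
                (q : ∀ j → ConnectedQuotient (F j) (H j)) where
  open ConnectedQuotient

  pullback : MinorSubproduct H → MinorSubproduct F
  pullback Mp = record
    { M              = M Mp
    ; part           = λ j x → part Mp j (map (q j) x)
    ; part-nonempty  = nonempty
    ; part-connected = λ j x y same →
        lift-walk (q j) (λ z → part Mp j z ≡ part Mp j (map (q j) x))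
                  (part-connected Mp j _ _ same) x y refl refl
    ; M-edges        = joining-edges
    }
    where
    nonempty : ∀ j l → ∃ λ x → part Mp j (map (q j) x) ≡ l
    nonempty j l with part-nonempty Mp j l
    ... | y , py with surjective (q j) y
    ...   | x , gx = x , trans (cong (part Mp j) gx) py

    joining-edges : ∀ j a b → Adj (M Mp j) a b →
            ∃₂ λ x y → part Mp j (map (q j) x) ≡ a × part Mp j (map (q j) y) ≡ b
                       × Adj (F j) x y
    joining-edges j a b ab with M-edges Mp j a b ab
    ... | x , y , px , py , xy with lift-edge (q j) x y xy
    ...   | x′ , y′ , gx , gy , x′y′ =
      x′ , y′ , trans (cong (part Mp j) gx) px , trans (cong (part Mp j) gy) py , x′y′

  pullback-shattered : (K : PV F → Set) (K′ : PV H → Set) →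
    (∀ y → K′ y → ∃ λ x → K x × (∀ j → map (q j) (x j) ≡ y j)) →
    (Mp : MinorSubproduct H) → Shattered K′ Mp → Shattered K (pullback Mp)
  pullback-shattered K K′ covered Mp shattered l with shattered l
  ... | y , K′y , py with covered y K′y
  ...   | x , Kx , gx = x , Kx , λ j → trans (cong (part Mp j) (gx j)) (py j)

contractMap-irrelevant : ∀ {k} (u v : Fin k) (p p′ : u ≢ v) x →
                         contractMap u v p x ≡ contractMap u v p′ x
contractMap-irrelevant {suc _} u v p p′ x with x ≟ v
... | yes _ = punchOut-cong v refl
... | no _  = punchOut-cong v refl

contractMap-surjective : ∀ {k} (u v : Fin k) (p : u ≢ v) y →
                         ∃ λ x → contractMap u v p x ≡ y
contractMap-surjective {suc _} u v p y = punchIn v y , image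
  where
  image : contractMap u v p (punchIn v y) ≡ y
  image with punchIn v y ≟ v
  ... | yes eq = ⊥-elim (punchInᵢ≢i v y eq)
  ... | no _   = trans (punchOut-cong v refl) (punchOut-punchIn v)

contractMap-fibres : ∀ {k} (u v : Fin k) (p : u ≢ v) x y →
                     contractMap u v p x ≡ contractMap u v p y →
                     x ≡ y ⊎ ((x ≡ u × y ≡ v) ⊎ (x ≡ v × y ≡ u))
contractMap-fibres {suc _} u v p x y same with x ≟ v | y ≟ v
... | yes x≡v | yes y≡v = inj₁ (trans x≡v (sym y≡v))
... | yes x≡v | no y≢v  =
  inj₂ (inj₂ (x≡v , sym (punchOut-injective {i = v} (p ∘ sym) (y≢v ∘ sym) same)))
... | no x≢v  | yes y≡v =
  inj₂ (inj₁ (punchOut-injective {i = v} (x≢v ∘ sym) (p ∘ sym) same , y≡v))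
... | no x≢v  | no y≢v  =
  inj₁ (punchOut-injective {i = v} (x≢v ∘ sym) (y≢v ∘ sym) same)

module _ (G : Graph) (u v : Fin (n G)) (e : Adj G u v) where

  u≢v : u ≢ v
  u≢v refl = adj-irrefl G e

  -- Contracting an edge is a connected quotient: the one non-trivial fibre
  -- {u, v} is joined by the edge e itself.
  contractionQuotient : ConnectedQuotient G (contract G u v e)
  contractionQuotient = record
    { map             = contractMap u v u≢v
    ; surjective      = contractMap-surjective u v u≢v
    ; fibre-connected = fibre-connected
    ; lift-edge       = lift-edge
    }
    where
    fibre-connected : ∀ x y → contractMap u v u≢v x ≡ contractMap u v u≢v y →
                      WalkIn G (λ z → contractMap u v u≢v z ≡ contractMap u v u≢v x) x y
    fibre-connected x y same with contractMap-fibres u v u≢v x y same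
    ... | inj₁ refl                 = here refl
    ... | inj₂ (inj₁ (refl , refl)) = step refl e (here (sym same))
    ... | inj₂ (inj₂ (refl , refl)) = step refl (adj-sym G e) (here (sym same))

    lift-edge : ∀ a b → Adj (contract G u v e) a b →
                ∃₂ λ x y → contractMap u v u≢v x ≡ a × contractMap u v u≢v y ≡ b
                           × Adj G x y
    lift-edge a b (_ , x , y , fx , fy , xy) =
      x , y , trans (contractMap-irrelevant u v _ _ x) fx
            , trans (contractMap-irrelevant u v _ _ y) fy , xy

module _ {m : ℕ} (F : Fin m → Graph) (i : Fin m) (u v : Fin (n (F i)))
         (e : Adj (F i) u v) where

  hatQuotient : ∀ j → ConnectedQuotient (F j) (hatF F i u v e j)
  hatQuotient j with i ≟ j
  ... | yes refl = contractionQuotient (F i) u v e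
  ... | no _     = identityQuotient (F j)

  φ-coordinates : ∀ x j → φ F i u v e x j ≡ ConnectedQuotient.map (hatQuotient j) (x j)
  φ-coordinates x j with i ≟ j
  ... | yes refl = contractMap-irrelevant u v _ _ (x i)
  ... | no _     = refl

  contractedSet-covered : (S : PV F → Set) → ∀ y → contractedSet F i u v e S y →
    ∃ λ x → S x × (∀ j → ConnectedQuotient.map (hatQuotient j) (x j) ≡ y j)
  contractedSet-covered S y (x , Sx , φx≡y) =
    x , Sx , λ j → trans (sym (φ-coordinates x j)) (φx≡y j)

lemma6p4 : (m : ℕ) (F : Fin m → Graph) (S : PV F → Set)
           (i : Fin m) (u v : Fin (n (F i))) (e : Adj (F i) u v) →
           VcdLe (hatF F i u v e) (contractedSet F i u v e S) F S
           × VcdensLe (hatF F i u v e) (contractedSet F i u v e S) F S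
lemma6p4 m F S i u v e =
    (λ Mp shattered → pullback Mp , shattered-pullback Mp shattered , ≤-refl)
  , (λ Mp shattered S′ nonempty →
       pullback Mp , shattered-pullback Mp shattered , S′ , nonempty , ≤-refl)
  where
  open Pullback (hatQuotient F i u v e)
  shattered-pullback : (Mp : MinorSubproduct (hatF F i u v e)) →
                       Shattered (contractedSet F i u v e S) Mp →
                       Shattered S (pullback Mp)
  shattered-pullback = pullback-shattered S (contractedSet F i u v e S)
                                          (contractedSet-covered F i u v e S)
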